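{- The subset $\mathcal N$ of the group $a\mathcal R$ of almost-Riordan arrays consisting of the matrices of the form $(a,1,x)$ (with $a_0=1$) is a subgroup, in which products are given by $$(a,1,x)\cdot(b,1,x)=(a+b-1,\,1,\,x),$$ and inverses by $$(a,1,x)^{ -1}=(a^*,1,x),\qquad a^*(x)=a_0\cdot 1-x\tilde a(x),$$ so that the first column of $(a,1,x)^{ -1}$ is $a_0,-a_1,-a_2,-a_3,\dots$.
   Context: All power series have integer coefficients. For a power series $h(x)=\sum h_nx^n$ write $\tilde h(x)=(h(x)-h_0)/x$. An almost-Riordan array is an ordered triple $(a,g,f)$ of power series with $a_0=1$, $g_0=1$, $f_0=0$, $f_1=1$, identified with the infinite lower-triangular matrix $M$ given by $M_{n,0}=a_n$, $M_{0,k}=0$ for $k\ge1$, $M_{n,k}=[x^{n-1}]g(x)f(x)^{k-1}$ for $n,k\ge1$. For a power series $h$, $(a,g,f)\cdot h$ is the power series whose coefficient sequence is $M(h_0,h_1,\dots)^T$. The group $a\mathcal R$ is the set of almost-Riordan arrays with product $(a,g,f)\cdot(b,u,v)=\big((a,g,f)\cdot b,\ g\,u(f),\ v(f)\big)$ and identity $(1,1,x)$. -}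

module Defs where

open import Data.Nat using (ℕ; zero; suc)
open import Data.Integer using (ℤ; +_; -_; _+_; _-_; _*_)
open import Data.Product using (_×_)
open import Relation.Binary.PropositionalEquality using (_≡_)

PS : Set
PS = ℕ → ℤ

_≈ₚ_ : PS → PS → Set
h ≈ₚ k = ∀ n → h n ≡ k n
infix 4 _≈ₚ_

sumTo : ℕ → (ℕ → ℤ) → ℤ
sumTo zero    f = + 0
sumTo (suc n) f = sumTo n f + f n

one : PS
one zero    = + 1
one (suc n) = + 0

X : PS
X zero          = + 0
X (suc zero)    = + 1
X (suc (suc n)) = + 0

_⊕_ : PS → PS → PS
(h ⊕ k) n = h n + k n

_⊖_ : PS → PS → PS
(h ⊖ k) n = h n - k n

scale : ℤ → PS → PS
scale c h n = c * h n

_⊛_ : PS → PS → PS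
(h ⊛ k) n = sumTo (suc n) (λ i → h i * k (n Data.Nat.∸ i))

pow : PS → ℕ → PS
pow h zero    = one
pow h (suc k) = h ⊛ pow h k

-- composition u(f) (meaningful when f 0 = 0): [x^n] u(f) = Σ_{k ≤ n} u_k [x^n] f^k
comp : PS → PS → PS
comp u f n = sumTo (suc n) (λ k → u k * pow f k n)

-- h̃(x) = (h(x) - h_0)/x
tilde : PS → PS
tilde h n = h (suc n)

xmul : PS → PS
xmul h zero    = + 0
xmul h (suc n) = h n

record Triple : Set where
  constructor ⟨_,_,_⟩
  field
    fst : PS
    snd : PS
    thd : PS
open Triple public

IsARA : Triple → Set
IsARA T = (fst T 0 ≡ + 1) × (snd T 0 ≡ + 1) × (thd T 0 ≡ + 0) × (thd T 1 ≡ + 1)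

entry : Triple → ℕ → ℕ → ℤ
entry T zero    zero    = fst T 0
entry T (suc n) zero    = fst T (suc n)
entry T zero    (suc k) = + 0
entry T (suc n) (suc k) = (snd T ⊛ pow (thd T) k) n

-- (a,g,f) · h : coefficient sequence M (h_0, h_1, ...)^T  (M lower triangular)
act : Triple → PS → PS
act T h n = sumTo (suc n) (λ k → entry T n k * h k)

_·_ : Triple → Triple → Triple
⟨ a , g , f ⟩ · ⟨ b , u , v ⟩ = ⟨ act ⟨ a , g , f ⟩ b , g ⊛ comp u f , comp v f ⟩

idA : Triple
idA = ⟨ one , one , X ⟩

_≈ₜ_ : Triple → Triple → Set
T ≈ₜ U = (fst T ≈ₚ fst U) × (snd T ≈ₚ snd U) × (thd T ≈ₚ thd U)
infix 4 _≈ₜ_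

InN : Triple → Set
InN T = IsARA T × (snd T ≈ₚ one) × (thd T ≈ₚ X)

astar : PS → PS
astar a = scale (a 0) one ⊖ xmul (tilde a)

-- For (a,1,x) the matrix is the identity with its first column replaced by a, so
-- (a,1,x)·h has coefficients a₀h₀ and a_{n+1}h₀ + h_{n+1}. Hence the first column
-- of (a,1,x)·(b,1,x) is a + b − 1 when a₀ = b₀ = 1, the second and third components
-- stay 1 and x because composing with x is the identity, and (a*,1,x) inverts
-- (a,1,x) since a_{n+1} + a*_{n+1} = 0.
module Submission where

open import Defs
open import Data.Nat using (ℕ; zero; suc; _∸_)
open import Data.Integer using (ℤ; +_; -_; _+_; _-_; _*_)
open import Data.Integer.Properties
  using (+-identityˡ; +-identityʳ; +-assoc; *-identityˡ; *-identityʳ; *-zeroʳ; *-comm;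
         +-inverseˡ; +-inverseʳ)
open import Data.Product using (_×_; Σ; _,_)
open import Relation.Binary.PropositionalEquality
  using (_≡_; refl; sym; trans; cong; cong₂; module ≡-Reasoning)

open ≡-Reasoning

≈ₚ-refl : ∀ {h} → h ≈ₚ h
≈ₚ-refl _ = refl

sumTo-cong : ∀ n {f g : ℕ → ℤ} → (∀ i → f i ≡ g i) → sumTo n f ≡ sumTo n g
sumTo-cong zero    f≗g = refl
sumTo-cong (suc n) f≗g = cong₂ _+_ (sumTo-cong n f≗g) (f≗g n)

sumTo-zero : ∀ n {f : ℕ → ℤ} → (∀ i → f i ≡ + 0) → sumTo n f ≡ + 0
sumTo-zero zero    f≗0 = refl
sumTo-zero (suc n) f≗0 = cong₂ _+_ (sumTo-zero n f≗0) (f≗0 n)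

sumTo-suc-head : ∀ n (f : ℕ → ℤ) → sumTo (suc n) f ≡ f 0 + sumTo n (λ i → f (suc i))
sumTo-suc-head zero    f = trans (+-identityˡ (f 0)) (sym (+-identityʳ (f 0)))
sumTo-suc-head (suc n) f = begin
  sumTo (suc n) f + f (suc n)                          ≡⟨ cong (_+ f (suc n)) (sumTo-suc-head n f) ⟩
  f 0 + sumTo n (λ i → f (suc i)) + f (suc n)          ≡⟨ +-assoc (f 0) _ (f (suc n)) ⟩
  f 0 + (sumTo n (λ i → f (suc i)) + f (suc n))        ∎

δ : ℕ → ℕ → ℤ
δ zero    zero    = + 1
δ zero    (suc n) = + 0
δ (suc k) zero    = + 0
δ (suc k) (suc n) = δ k n

sumTo-δ : ∀ n (u : ℕ → ℤ) → sumTo (suc n) (λ k → δ k n * u k) ≡ u n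
sumTo-δ zero    u = trans (+-identityˡ _) (*-identityˡ (u 0))
sumTo-δ (suc n) u = begin
  sumTo (suc (suc n)) (λ k → δ k (suc n) * u k)        ≡⟨ sumTo-suc-head (suc n) _ ⟩
  + 0 + sumTo (suc n) (λ k → δ k n * u (suc k))        ≡⟨ +-identityˡ _ ⟩
  sumTo (suc n) (λ k → δ k n * u (suc k))              ≡⟨ sumTo-δ n (λ k → u (suc k)) ⟩
  u (suc n)                                            ∎

⊛-cong : ∀ {g g′ h h′} → g ≈ₚ g′ → h ≈ₚ h′ → g ⊛ h ≈ₚ g′ ⊛ h′
⊛-cong g≈g′ h≈h′ n = sumTo-cong (suc n) (λ i → cong₂ _*_ (g≈g′ i) (h≈h′ (n ∸ i)))

one-⊛ : ∀ h → one ⊛ h ≈ₚ h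
one-⊛ h n = begin
  (one ⊛ h) n                                          ≡⟨ sumTo-suc-head n _ ⟩
  + 1 * h n + sumTo n (λ i → + 0 * h (n ∸ suc i))      ≡⟨ cong₂ _+_ (*-identityˡ (h n)) (sumTo-zero n (λ _ → refl)) ⟩
  h n + + 0                                            ≡⟨ +-identityʳ (h n) ⟩
  h n                                                  ∎

X-suc : ∀ i → X (suc i) ≡ one i
X-suc zero    = refl
X-suc (suc i) = refl

X-⊛ : ∀ h → X ⊛ h ≈ₚ xmul h
X-⊛ h zero    = refl
X-⊛ h (suc n) = begin
  (X ⊛ h) (suc n)                                      ≡⟨ sumTo-suc-head (suc n) _ ⟩
  + 0 + sumTo (suc n) (λ i → X (suc i) * h (n ∸ i))    ≡⟨ +-identityˡ _ ⟩
  sumTo (suc n) (λ i → X (suc i) * h (n ∸ i))          ≡⟨ sumTo-cong (suc n) (λ i → cong (_* h (n ∸ i)) (X-suc i)) ⟩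
  (one ⊛ h) n                                          ≡⟨ one-⊛ h n ⟩
  h n                                                  ∎

pow-cong : ∀ {f f′} → f ≈ₚ f′ → ∀ k → pow f k ≈ₚ pow f′ k
pow-cong f≈f′ zero    n = refl
pow-cong f≈f′ (suc k)   = ⊛-cong f≈f′ (pow-cong f≈f′ k)

pow-X : ∀ k n → pow X k n ≡ δ k n
pow-X zero    zero    = refl
pow-X zero    (suc n) = refl
pow-X (suc k) zero    = refl
pow-X (suc k) (suc n) = trans (X-⊛ (pow X k) (suc n)) (pow-X k n)

comp-X : ∀ u {f} → f ≈ₚ X → comp u f ≈ₚ u
comp-X u f≈X n = begin
  sumTo (suc n) (λ k → u k * pow _ k n)                ≡⟨ sumTo-cong (suc n) (λ k → trans
                                                            (cong (_*_ (u k)) (trans (pow-cong f≈X k n) (pow-X k n)))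
                                                            (*-comm (u k) (δ k n))) ⟩
  sumTo (suc n) (λ k → δ k n * u k)                    ≡⟨ sumTo-δ n u ⟩
  u n                                                  ∎

module _ (T : Triple) (g≈1 : snd T ≈ₚ one) (f≈X : thd T ≈ₚ X) where

  entry-suc-suc : ∀ n k → entry T (suc n) (suc k) ≡ δ k n
  entry-suc-suc n k = begin
    (snd T ⊛ pow (thd T) k) n                          ≡⟨ ⊛-cong g≈1 (pow-cong f≈X k) n ⟩
    (one ⊛ pow X k) n                                  ≡⟨ one-⊛ (pow X k) n ⟩
    pow X k n                                          ≡⟨ pow-X k n ⟩
    δ k n                                              ∎

  act-suc : ∀ h n → act T h (suc n) ≡ fst T (suc n) * h 0 + h (suc n)
  act-suc h n = begin
    act T h (suc n)                                    ≡⟨ sumTo-suc-head (suc n) _ ⟩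
    fst T (suc n) * h 0 + sumTo (suc n) (λ k → entry T (suc n) (suc k) * h (suc k))
      ≡⟨ cong (_+_ (fst T (suc n) * h 0)) (sumTo-cong (suc n) (λ k → cong (_* h (suc k)) (entry-suc-suc n k))) ⟩
    fst T (suc n) * h 0 + sumTo (suc n) (λ k → δ k n * h (suc k))
      ≡⟨ cong (_+_ (fst T (suc n) * h 0)) (sumTo-δ n (λ k → h (suc k))) ⟩
    fst T (suc n) * h 0 + h (suc n)                    ∎

  ·-fst-suc : ∀ U n → fst (T · U) (suc n) ≡ fst T (suc n) * fst U 0 + fst U (suc n)
  ·-fst-suc ⟨ b , u , v ⟩ = act-suc b

  ·-snd : ∀ U → snd (T · U) ≈ₚ snd U
  ·-snd ⟨ b , u , v ⟩ n = begin
    (snd T ⊛ comp u (thd T)) n                         ≡⟨ ⊛-cong g≈1 (≈ₚ-refl {comp u (thd T)}) n ⟩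
    (one ⊛ comp u (thd T)) n                           ≡⟨ one-⊛ (comp u (thd T)) n ⟩
    comp u (thd T) n                                   ≡⟨ comp-X u f≈X n ⟩
    u n                                                ∎

  ·-thd : ∀ U → thd (T · U) ≈ₚ thd U
  ·-thd ⟨ b , u , v ⟩ = comp-X v f≈X

·-fst-zero : ∀ T U → fst (T · U) 0 ≡ fst T 0 * fst U 0
·-fst-zero ⟨ a , g , f ⟩ ⟨ b , u , v ⟩ = +-identityˡ _

InN-closed : ∀ T U → InN T → InN U → InN (T · U)
InN-closed T U ((a₀≡1 , _) , g≈1 , f≈X) ((b₀≡1 , u₀≡1 , v₀≡0 , v₁≡1) , u≈1 , v≈X) =
  ( ( trans (·-fst-zero T U) (cong₂ _*_ a₀≡1 b₀≡1)
    , trans (·-snd T g≈1 f≈X U 0) u₀≡1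
    , trans (·-thd T g≈1 f≈X U 0) v₀≡0
    , trans (·-thd T g≈1 f≈X U 1) v₁≡1 )
  , (λ n → trans (·-snd T g≈1 f≈X U n) (u≈1 n))
  , (λ n → trans (·-thd T g≈1 f≈X U n) (v≈X n)) )

InN-canonical : ∀ a → a 0 ≡ + 1 → InN ⟨ a , one , X ⟩
InN-canonical a a₀≡1 = (a₀≡1 , refl , refl , refl) , ≈ₚ-refl , ≈ₚ-refl

astar-zero : ∀ a → astar a 0 ≡ a 0
astar-zero a = trans (+-identityʳ _) (*-identityʳ (a 0))

astar-suc : ∀ a n → astar a (suc n) ≡ - a (suc n)
astar-suc a n = trans (cong (_+ - a (suc n)) (*-zeroʳ (a 0))) (+-identityˡ _)

inverseN : Triple → Triple
inverseN T = ⟨ astar (fst T) , one , X ⟩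

InN-inverseN : ∀ T → InN T → InN (inverseN T)
InN-inverseN T ((a₀≡1 , _) , _) = InN-canonical (astar (fst T)) (trans (astar-zero (fst T)) a₀≡1)

·-inverseN : ∀ T → InN T → T · inverseN T ≈ₜ idA
·-inverseN T ((a₀≡1 , _) , g≈1 , f≈X) =
  first-column , ·-snd T g≈1 f≈X (inverseN T) , ·-thd T g≈1 f≈X (inverseN T)
  where
  a = fst T
  first-column : fst (T · inverseN T) ≈ₚ one
  first-column zero    = trans (·-fst-zero T (inverseN T)) (cong₂ _*_ a₀≡1 (trans (astar-zero a) a₀≡1))
  first-column (suc n) = begin
    fst (T · inverseN T) (suc n)                       ≡⟨ ·-fst-suc T g≈1 f≈X (inverseN T) n ⟩
    a (suc n) * astar a 0 + astar a (suc n)            ≡⟨ cong₂ _+_ (cong (_*_ (a (suc n))) (trans (astar-zero a) a₀≡1))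
                                                                    (astar-suc a n) ⟩
    a (suc n) * + 1 + - a (suc n)                      ≡⟨ cong (_+ - a (suc n)) (*-identityʳ (a (suc n))) ⟩
    a (suc n) + - a (suc n)                            ≡⟨ +-inverseʳ (a (suc n)) ⟩
    + 0                                                ∎

inverseN-· : ∀ T → InN T → inverseN T · T ≈ₜ idA
inverseN-· T ((a₀≡1 , _) , g≈1 , f≈X) =
  first-column
  , (λ n → trans (·-snd S ≈ₚ-refl ≈ₚ-refl T n) (g≈1 n))
  , (λ n → trans (·-thd S ≈ₚ-refl ≈ₚ-refl T n) (f≈X n))
  where
  a = fst T
  S = inverseN T
  first-column : fst (S · T) ≈ₚ one
  first-column zero    = trans (·-fst-zero S T) (cong₂ _*_ (trans (astar-zero a) a₀≡1) a₀≡1)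
  first-column (suc n) = begin
    fst (S · T) (suc n)                                ≡⟨ ·-fst-suc S ≈ₚ-refl ≈ₚ-refl T n ⟩
    astar a (suc n) * a 0 + a (suc n)                  ≡⟨ cong (_+ a (suc n)) (cong₂ _*_ (astar-suc a n) a₀≡1) ⟩
    - a (suc n) * + 1 + a (suc n)                      ≡⟨ cong (_+ a (suc n)) (*-identityʳ (- a (suc n))) ⟩
    - a (suc n) + a (suc n)                            ≡⟨ +-inverseˡ (a (suc n)) ⟩
    + 0                                                ∎

·-canonical : ∀ a b → a 0 ≡ + 1 → b 0 ≡ + 1 →
              ⟨ a , one , X ⟩ · ⟨ b , one , X ⟩ ≈ₜ ⟨ (a ⊕ b) ⊖ one , one , X ⟩
·-canonical a b a₀≡1 b₀≡1 = first-column , ·-snd T ≈ₚ-refl ≈ₚ-refl U , ·-thd T ≈ₚ-refl ≈ₚ-refl U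
  where
  T = ⟨ a , one , X ⟩
  U = ⟨ b , one , X ⟩
  first-column : fst (T · U) ≈ₚ (a ⊕ b) ⊖ one
  first-column zero    = begin
    fst (T · U) 0                                      ≡⟨ ·-fst-zero T U ⟩
    a 0 * b 0                                          ≡⟨ cong₂ _*_ a₀≡1 b₀≡1 ⟩
    + 1                                                ≡⟨ cong₂ (λ x y → x + y - + 1) a₀≡1 b₀≡1 ⟨
    a 0 + b 0 - + 1                                    ∎
  first-column (suc n) = begin
    fst (T · U) (suc n)                                ≡⟨ ·-fst-suc T ≈ₚ-refl ≈ₚ-refl U n ⟩
    a (suc n) * b 0 + b (suc n)                        ≡⟨ cong (λ c → a (suc n) * c + b (suc n)) b₀≡1 ⟩
    a (suc n) * + 1 + b (suc n)                        ≡⟨ cong (_+ b (suc n)) (*-identityʳ (a (suc n))) ⟩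
    a (suc n) + b (suc n)                              ≡⟨ +-identityʳ _ ⟨
    a (suc n) + b (suc n) - + 0                        ∎

mainTheorem6 :
    (InN idA
      × (∀ T U → InN T → InN U → InN (T · U))
      × (∀ T → InN T → Σ Triple (λ S → InN S × (T · S ≈ₜ idA) × (S · T ≈ₜ idA))))
    × (∀ (a b : PS) → a 0 ≡ + 1 → b 0 ≡ + 1 →
         ⟨ a , one , X ⟩ · ⟨ b , one , X ⟩ ≈ₜ ⟨ (a ⊕ b) ⊖ one , one , X ⟩)
    × (∀ (a : PS) → a 0 ≡ + 1 →
         InN ⟨ astar a , one , X ⟩
         × (⟨ a , one , X ⟩ · ⟨ astar a , one , X ⟩ ≈ₜ idA)
         × (⟨ astar a , one , X ⟩ · ⟨ a , one , X ⟩ ≈ₜ idA)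
         × (astar a 0 ≡ a 0)
         × (∀ n → astar a (suc n) ≡ - a (suc n)))
mainTheorem6 =
  ( ( InN-canonical one refl
    , InN-closed
    , λ T T∈N → inverseN T , InN-inverseN T T∈N , ·-inverseN T T∈N , inverseN-· T T∈N )
  , ·-canonical
  , λ a a₀≡1 → let T = ⟨ a , one , X ⟩; T∈N = InN-canonical a a₀≡1 in
      InN-inverseN T T∈N , ·-inverseN T T∈N , inverseN-· T T∈N , astar-zero a , astar-suc a )
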